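{- Let $k\geq 4$ and let $\xi$, $\mathbf{u}$, $\pi$ be as in the context. Let $w\neq\varepsilon$ be a bispecial factor of $\mathbf{u}$, and assume there exist letters $x,y\in\mathrm{Rext}(w)$ with $x\neq y$ and $\pi(x)=\pi(y)$. Then $w$ or its twin equals $\xi^\ell(0)$ for some integer $\ell$ with $0\leq\ell\leq 2k-2$ and $\ell\neq k-1$. Moreover, if $u,v\in\mathcal{A}^*$ are such that $wxu$ and $wyv$ are factors of $\mathbf{u}$ and $\pi(wxu)=\pi(wyv)$, then $|u|=|v|\leq 1$ if $0\leq\ell\leq k-2$, and $|u|=|v|=0$ if $k\leq\ell\leq 2k-2$.
   Context: Fix an integer $k\geq 4$. Let $\mathcal{A}=\{0,1,\ldots,k-1,0',1',\ldots,(k-1)'\}$. Let $\xi:\mathcal{A}^*\to\mathcal{A}^*$ be the morphism given by $\xi(0)=01$, $\xi(j)=j+1$ for $1\leq j\leq k-2$, $\xi(k-1)=0'$, and $\xi(0')=0'1'$, $\xi(j')=(j+1)'$ for $1\leq j\leq k-2$, $\xi((k-1)')=0$; $\xi^0$ is the identity. Let $\mathbf{u}=\xi^\omega(0)$ be the infinite fixed point of $\xi$ starting with $0$. Let $\pi:\mathcal{A}^*\to\{0,1\}^*$ be the letter-to-letter morphism with $\pi(0)=0$, $\pi(j')=0$ for $1\leq j\leq k-1$, $\pi(0')=1$, $\pi(j)=1$ for $1\leq j\leq k-1$. The twin of a word over $\mathcal{A}$ is obtained by the letter exchange $\ell\leftrightarrow\ell'$ ($\ell=0,\ldots,k-1$).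 For a factor $w$, $\mathrm{Rext}(w)$ (resp. $\mathrm{Lext}(w)$) is the set of letters $a$ with $wa$ (resp. $aw$) a factor of $\mathbf{u}$; $w$ is bispecial if $\#\mathrm{Lext}(w)\geq2$ and $\#\mathrm{Rext}(w)\geq 2$. -}

module Defs where

open import Data.Nat using (ℕ; zero; suc; _+_; _<ᵇ_)
open import Data.Bool using (Bool; true; false; not; if_then_else_)
open import Data.Product using (_×_; _,_; ∃; Σ)
open import Data.List using (List; []; _∷_; _++_; map; concatMap; upTo; length)
open import Relation.Binary.PropositionalEquality using (_≡_; _≢_)

-- A letter is a pair (j , b): j is the index ℓ ∈ {0,…,k-1}, b = true means
-- the primed copy ℓ'.  So (j , false) = j and (j , true) = j'.
Letter : Set
Letter = ℕ × Bool

-- The morphism ξ (for a fixed k), on letters.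
--   ξ(0) = 01, ξ(j) = j+1 (1 ≤ j ≤ k-2), ξ(k-1) = 0', and the primed twins.
ξstep : ℕ → ℕ → Bool → List Letter
ξstep k j b = if suc j <ᵇ k then (suc j , b) ∷ [] else (0 , not b) ∷ []

ξ : ℕ → Letter → List Letter
ξ k (zero , b) = (0 , b) ∷ ξstep k 0 b
ξ k (suc j , b) = ξstep k (suc j) b

ξ* : ℕ → List Letter → List Letter
ξ* k w = concatMap (ξ k) w

ξ^ : ℕ → ℕ → List Letter → List Letter
ξ^ k zero w = w
ξ^ k (suc n) w = ξ* k (ξ^ k n w)

w0 : List Letter
w0 = (0 , false) ∷ []

at : {A : Set} → List A → ℕ → A → A
at [] n d = d
at (x ∷ xs) zero d = x
at (x ∷ xs) (suc n) d = at xs n d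

-- The fixed point u = ξ^ω(0): its i-th letter (0-indexed) is the i-th letter
-- of the prefix ξ^i(0), which has length ≥ i+1 (so the default is never used).
uu : ℕ → ℕ → Letter
uu k i = at (ξ^ k i w0) i (0 , false)

slice : ℕ → ℕ → ℕ → List Letter
slice k i n = map (λ j → uu k (i + j)) (upTo n)

IsFactor : ℕ → List Letter → Set
IsFactor k w = ∃ λ i → slice k i (length w) ≡ w

InRext : ℕ → List Letter → Letter → Set
InRext k w x = IsFactor k (w ++ x ∷ [])

InLext : ℕ → List Letter → Letter → Set
InLext k w x = IsFactor k (x ∷ w)

Bispecial : ℕ → List Letter → Set
Bispecial k w =
  (Σ Letter λ a → Σ Letter λ b → a ≢ b × InLext k w a × InLext k w b) ×
  (Σ Letter λ a → Σ Letter λ b → a ≢ b × InRext k w a × InRext k w b)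

-- π : letter-to-letter morphism to {0,1} (false = 0, true = 1):
-- π(0)=0, π(0')=1, π(j)=1, π(j')=0 for j ≥ 1.
πL : Letter → Bool
πL (zero , b) = b
πL (suc j , b) = not b

π : List Letter → List Bool
π = map πL

twin : List Letter → List Letter
twin = map (λ { (j , b) → (j , not b) })

{-# OPTIONS --safe #-}
module Submission where

open import Data.Bool using (Bool; true; false; not; if_then_else_)
open import Data.Bool.Properties using (not-involutive; not-injective; not-¬; ¬-not)
import Data.Bool.Properties as Bool
open import Data.Empty using (⊥)
open import Data.List using (List; []; _∷_; _++_; length; applyUpTo)
open import Data.List.Base using (initLast; _∷ʳ′_)
open import Data.List.Properties
  using (++-assoc; ++-identityʳ; ++-cancelˡ; ++-conicalʳ; ∷-injective; ∷-injectiveˡ; ∷-injectiveʳ;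
         ∷ʳ-injectiveʳ; length-map; length-++-≤ˡ; length-++-≤ʳ; length-++-sucʳ; map-++; map-cong-local;
         map-applyUpTo; concatMap-++)
open import Data.List.Relation.Unary.All as All using (All; []; _∷_)
import Data.List.Relation.Unary.All.Properties as Allₚ
open import Data.Nat using (ℕ; zero; suc; _+_; _∸_; _*_; _≤_; _<_; _<ᵇ_; z≤n; s≤s; s≤s⁻¹; _≟_; _<?_)
open import Data.Nat.Properties
  using (≤-refl; ≤-trans; ≤-antisym; <-trans; <⇒≤; <⇒≢; >⇒≢; <⇒≱; ≮⇒≥; ≤∧≢⇒<; n<1+n; suc-injective;
         +-identityʳ; m≤n+m; +-monoʳ-≤; +-cancelʳ-<; m∸n+n≡m; <ᵇ-reflects-<; module ≤-Reasoning)
open import Data.Product using (Σ; ∃; ∃₂; _×_; _,_; proj₁; proj₂)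
open import Data.Product.Properties using (,-injectiveˡ; ,-injectiveʳ; ≡-dec)
open import Data.Sum using (_⊎_; inj₁; inj₂)
open import Function using (case_of_; _∘_; id)
open import Relation.Nullary using (¬_; Dec; yes; no; contradiction)
open import Relation.Nullary.Reflects using (ofʸ; ofⁿ)
open import Relation.Binary.PropositionalEquality

open import Defs

-- A letter (j , b) of u can only be followed by a letter of index 0 or by (suc j , b), and a
-- letter (1 , b) only occurs inside a block ξ (0 , b) = (0 , b) (1 , b). Hence ξ is injective on
-- words over the alphabet, and a factor cut out of u in front of a letter of index ≠ 1 is cut
-- along block boundaries, so it desubstitutes uniquely. A nonempty left special factor w thus
-- starts with a 0, and two distinct right extensions with equal π-image are (suc j , b) and
-- (0 , not b), where (j , b) is the last letter of w. If j > 0, w is the image of a shorter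
-- factor with the same two properties; if j = 0 and |w| > 1, w without its last letter is the
-- image of a left special Z followed both by (0 , b) and by (k-1 , not b) (0 , not b). By
-- induction on |w|, w = ξ^ℓ(0) or its twin; ℓ = k - 1 and ℓ = 2k - 1 are impossible because
-- there w ends in a letter of index k - 1, which has no successor of the same colour.
-- For the extensions, (j , b) (0 , not b) must continue with (1 , not b), which forces the other
-- branch to continue with (0 , b), and one more letter of equal π-image would make
-- (suc j , b) (0 , b) (0 , b) a factor, whose middle 0 must be preceded by (k-1 , not b).
-- For ℓ ≥ k, writing i' for (i , not c), the first forced letter already creates a factor
-- ξ^m (k-1 , c) 0' 1' … (m+1)' 0'; desubstitution shrinks it to (k-1 , c) 0' 1' 0', but the
-- only letter that can precede 0' 1' 0' is 0'.

infix 4 _⊑_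

_⊑_ : {A : Set} → List A → List A → Set
t ⊑ L = ∃₂ λ p s → L ≡ p ++ t ++ s

⊑-trans : ∀ {A : Set} {t u L : List A} → t ⊑ u → u ⊑ L → t ⊑ L
⊑-trans {t = t} (p , s , refl) (p' , s' , refl) =
  p' ++ p , s ++ s' , (begin
    p' ++ (p ++ t ++ s) ++ s' ≡⟨ cong (p' ++_) (++-assoc p (t ++ s) s') ⟩
    p' ++ p ++ (t ++ s) ++ s' ≡⟨ cong (λ x → p' ++ p ++ x) (++-assoc t s s') ⟩
    p' ++ p ++ t ++ s ++ s'   ≡⟨ sym (++-assoc p' p _) ⟩
    (p' ++ p) ++ t ++ s ++ s' ∎)
  where open ≡-Reasoning

⊑-++ʳ : ∀ {A : Set} {t L : List A} M → t ⊑ L → t ⊑ L ++ M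
⊑-++ʳ {t = t} M (p , s , refl) =
  p , s ++ M , trans (++-assoc p (t ++ s) M) (cong (p ++_) (++-assoc t s M))

++-prefix-⊑ : ∀ {A : Set} (t u s : List A) → t ++ u ⊑ t ++ u ++ s
++-prefix-⊑ t u s = [] , s , sym (++-assoc t u s)

suffix-⊑ : ∀ {A : Set} (p t : List A) → t ⊑ p ++ t
suffix-⊑ p t = p , [] , cong (p ++_) (sym (++-identityʳ t))

prefix-⊑ : ∀ {A : Set} (t s : List A) → t ⊑ t ++ s
prefix-⊑ t s = [] , s , refl

∷ʳ-⊑ : ∀ {A : Set} {t L : List A} p x s → L ≡ p ++ t ++ x ∷ s → t ++ x ∷ [] ⊑ L
∷ʳ-⊑ {t = t} p x s eq = p , s , trans eq (cong (p ++_) (sym (++-assoc t (x ∷ []) s)))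

⊑-All : ∀ {A : Set} {P : A → Set} {t L : List A} → t ⊑ L → All P L → All P t
⊑-All {t = t} (p , s , refl) ps = Allₚ.++⁻ˡ t (Allₚ.++⁻ʳ p ps)

at-++ : ∀ {A : Set} (L M : List A) {j d} → j < length L → at (L ++ M) j d ≡ at L j d
at-++ (x ∷ L) M {zero}  _        = refl
at-++ (x ∷ L) M {suc j} (s≤s lt) = at-++ L M lt

at-prefix : ∀ {A : Set} (L : List A) m d → m ≤ length L → ∃ λ s → L ≡ applyUpTo (λ j → at L j d) m ++ s
at-prefix L       zero    d _        = L , refl
at-prefix (x ∷ L) (suc m) d (s≤s le) with at-prefix L m d le
... | s , eq = s , cong (x ∷_) eq

at-infix : ∀ {A : Set} (L : List A) i m d → i + m ≤ length L → applyUpTo (λ j → at L (i + j) d) m ⊑ L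
at-infix L       zero    m d le with at-prefix L m d le
... | s , eq = [] , s , eq
at-infix (x ∷ L) (suc i) m d (s≤s le) with at-infix L i m d le
... | p , s , eq = x ∷ p , s , cong (x ∷_) eq

π-cancelˡ : ∀ w {x y u v} → π (w ++ x ∷ u) ≡ π (w ++ y ∷ v) → π u ≡ π v
π-cancelˡ w {x} {y} {u} {v} eq =
  ∷-injectiveʳ (++-cancelˡ (π w) _ _ (trans (sym (map-++ πL w (x ∷ u))) (trans eq (map-++ πL w (y ∷ v)))))

π-length : ∀ {u v} → π u ≡ π v → length u ≡ length v
π-length {u} {v} eq = trans (sym (length-map πL u)) (trans (cong length eq) (length-map πL v))

module FixedPoint (n : ℕ) where

  k top : ℕ
  k   = 4 + n
  top = 3 + n

  Valid : Letter → Set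
  Valid (j , _) = j < k

  _≟L_ : (a a' : Letter) → Dec (a ≡ a')
  _≟L_ = ≡-dec _≟_ Bool._≟_

  not≢self : ∀ {b} → not b ≢ b
  not≢self eq = not-¬ refl (sym eq)

  rot : Letter → Letter
  rot (j , b) = if suc j <ᵇ k then (suc j , b) else (0 , not b)

  rot-step : ∀ {j b} → suc j < k → rot (j , b) ≡ (suc j , b)
  rot-step {j} lt with suc j <ᵇ k | <ᵇ-reflects-< (suc j) k
  ... | true  | _       = refl
  ... | false | ofⁿ ¬lt = contradiction lt ¬lt

  rot-wrap : ∀ {j b} → k ≤ suc j → rot (j , b) ≡ (0 , not b)
  rot-wrap {j} ge with suc j <ᵇ k | <ᵇ-reflects-< (suc j) k
  ... | true  | ofʸ lt = contradiction ge (<⇒≱ lt)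
  ... | false | _      = refl

  data RotView (j : ℕ) (b : Bool) : Set where
    step : suc j < k → rot (j , b) ≡ (suc j , b) → RotView j b
    wrap : k ≤ suc j → rot (j , b) ≡ (0 , not b) → RotView j b

  rot-view : ∀ j b → RotView j b
  rot-view j b with suc j <? k
  ... | yes lt = step lt (rot-step lt)
  ... | no ¬lt = wrap (≮⇒≥ ¬lt) (rot-wrap (≮⇒≥ ¬lt))

  rot-top : ∀ {b} → rot (top , b) ≡ (0 , not b)
  rot-top = rot-wrap ≤-refl

  rot-injective : ∀ {a a'} → Valid a → Valid a' → rot a ≡ rot a' → a ≡ a'
  rot-injective {j , b} {j' , b'} v v' eq with rot-view j b | rot-view j' b'
  ... | step _ e | step _ e' with trans (sym e) (trans eq e')
  ...   | refl = refl
  rot-injective {j , b} {j' , b'} v v' eq | wrap ge e | wrap ge' e' =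
    cong₂ _,_ (suc-injective (trans (≤-antisym v ge) (sym (≤-antisym v' ge'))))
              (not-injective (,-injectiveʳ (trans (sym e) (trans eq e'))))
  rot-injective {j , b} {j' , b'} v v' eq | step _ e | wrap _ e' =
    case trans (sym e) (trans eq e') of λ ()
  rot-injective {j , b} {j' , b'} v v' eq | wrap _ e | step _ e' =
    case trans (sym e) (trans eq e') of λ ()

  ξ-suc : ∀ j b → ξ k (suc j , b) ≡ rot (suc j , b) ∷ []
  ξ-suc j b with suc (suc j) <ᵇ k
  ... | true  = refl
  ... | false = refl

  ξ-top : ∀ {b} → ξ k (top , b) ≡ (0 , not b) ∷ []
  ξ-top {b} = trans (ξ-suc (2 + n) b) (cong (_∷ []) rot-top)

  first : Letter → Letter
  first (zero , b)  = (0 , b)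
  first (suc j , b) = rot (suc j , b)

  ξ-first : ∀ a → ∃ λ r → ξ k a ≡ first a ∷ r
  ξ-first (zero , b)  = (1 , b) ∷ [] , refl
  ξ-first (suc j , b) = [] , ξ-suc j b

  ξ-last : ∀ a → ∃ λ r → ξ k a ≡ r ++ rot a ∷ []
  ξ-last (zero , b)  = (0 , b) ∷ [] , refl
  ξ-last (suc j , b) = [] , ξ-suc j b

  first≢1 : ∀ a → proj₁ (first a) ≢ 1
  first≢1 (zero , b)  = λ ()
  first≢1 (suc j , b) with rot-view (suc j) b
  ... | step _ e rewrite e = λ ()
  ... | wrap _ e rewrite e = λ ()

  πL-first : ∀ a → πL (first a) ≡ πL a
  πL-first (zero , b)  = refl
  πL-first (suc j , b) with rot-view (suc j) b
  ... | step _ e rewrite e = refl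
  ... | wrap _ e rewrite e = refl

  first≡0 : ∀ {e b} → Valid e → first e ≡ (0 , b) → e ≡ (0 , b) ⊎ e ≡ (top , not b)
  first≡0 {zero , _}  _ eq = inj₁ eq
  first≡0 {suc j , c} v eq with rot-view (suc j) c
  ... | step _ e = case trans (sym e) eq of λ ()
  ... | wrap ge e with trans (sym e) eq
  ...   | refl = inj₂ (cong₂ _,_ (suc-injective (≤-antisym v ge)) (sym (not-involutive c)))

  ξs : List Letter → List Letter
  ξs = ξ* k

  ξs-++ : ∀ X Y → ξs (X ++ Y) ≡ ξs X ++ ξs Y
  ξs-++ = concatMap-++ (ξ k)

  rot-valid : ∀ a → Valid (rot a)
  rot-valid (j , b) with rot-view j b
  ... | step lt e rewrite e = lt
  ... | wrap _  e rewrite e = s≤s z≤n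

  ξ-valid : ∀ a → All Valid (ξ k a)
  ξ-valid (zero , b)  = s≤s z≤n ∷ s≤s (s≤s z≤n) ∷ []
  ξ-valid (suc j , b) rewrite ξ-suc j b = rot-valid (suc j , b) ∷ []

  ξs-valid : ∀ Z → All Valid (ξs Z)
  ξs-valid []      = []
  ξs-valid (a ∷ Z) = Allₚ.++⁺ (ξ-valid a) (ξs-valid Z)

  -- (1 , b) occurs in an image only as the second letter of ξ (0 , b), so an image cut in front
  -- of any other letter is cut between blocks.
  HeadNot1 : List Letter → Set
  HeadNot1 []            = ⊥
  HeadNot1 ((j , _) ∷ _) = j ≢ 1

  HeadNot1-++ : ∀ w {s} → HeadNot1 w → HeadNot1 (w ++ s)
  HeadNot1-++ (_ ∷ _) h = h

  ξs-HeadNot1 : ∀ Z {s} → HeadNot1 s → HeadNot1 (ξs Z ++ s)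
  ξs-HeadNot1 []      h = h
  ξs-HeadNot1 (a ∷ Z) _ rewrite proj₂ (ξ-first a) = first≢1 a

  ξs≢1∷ : ∀ Z {b s} → ξs Z ≢ (1 , b) ∷ s
  ξs≢1∷ []      ()
  ξs≢1∷ (a ∷ Z) eq rewrite proj₂ (ξ-first a) = first≢1 a (,-injectiveˡ (∷-injectiveˡ eq))

  ξ-++-injective : ∀ {a a' r r'} → Valid a → Valid a' →
                   ξ k a ++ ξs r ≡ ξ k a' ++ ξs r' → a ≡ a' × ξs r ≡ ξs r'
  ξ-++-injective {zero , b} {zero , b'} _ _ eq with ∷-injective eq
  ... | refl , eq' = refl , ∷-injectiveʳ eq'
  ξ-++-injective {zero , b} {suc j' , b'} {r' = r'} _ _ eq rewrite ξ-suc j' b' =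
    contradiction (sym (∷-injectiveʳ eq)) (ξs≢1∷ r')
  ξ-++-injective {suc j , b} {zero , b'} {r} _ _ eq rewrite ξ-suc j b =
    contradiction (∷-injectiveʳ eq) (ξs≢1∷ r)
  ξ-++-injective {suc j , b} {suc j' , b'} v v' eq rewrite ξ-suc j b | ξ-suc j' b'
    with ∷-injective eq
  ... | e , eq' with rot-injective v v' e
  ...   | refl = refl , eq'

  ξs-injective : ∀ {Z Z'} → All Valid Z → All Valid Z' → ξs Z ≡ ξs Z' → Z ≡ Z'
  ξs-injective {[]}    {[]}     _ _ _ = refl
  ξs-injective {[]}    {a ∷ _}  _ _ eq rewrite proj₂ (ξ-first a) = case eq of λ ()
  ξs-injective {a ∷ _} {[]}     _ _ eq rewrite proj₂ (ξ-first a) = case eq of λ ()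
  ξs-injective {a ∷ Z} {a' ∷ Z'} (v ∷ vs) (v' ∷ vs') eq with ξ-++-injective {r = Z} {r' = Z'} v v' eq
  ... | refl , eq' = cong (a ∷_) (ξs-injective vs vs' eq')

  data ImageSplit (Z p q : List Letter) : Set where
    aligned  : ∀ Z₁ Z₂ → Z ≡ Z₁ ++ Z₂ → ξs Z₁ ≡ p → ξs Z₂ ≡ q → ImageSplit Z p q
    inside-0 : ∀ Z₁ Z₂ b → Z ≡ Z₁ ++ (0 , b) ∷ Z₂ →
               p ≡ ξs Z₁ ++ (0 , b) ∷ [] → q ≡ (1 , b) ∷ ξs Z₂ → ImageSplit Z p q

  ImageSplit-∷ : ∀ a {Z p q p'} → ξ k a ++ p ≡ p' → ImageSplit Z p q → ImageSplit (a ∷ Z) p' q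
  ImageSplit-∷ a refl (aligned Z₁ Z₂ refl refl eq₂) =
    aligned (a ∷ Z₁) Z₂ refl refl eq₂
  ImageSplit-∷ a refl (inside-0 Z₁ Z₂ b refl refl eq₂) =
    inside-0 (a ∷ Z₁) Z₂ b refl (sym (++-assoc (ξ k a) (ξs Z₁) _)) eq₂

  image-split : ∀ Z p q → ξs Z ≡ p ++ q → ImageSplit Z p q
  image-split Z       []      q eq = aligned [] Z refl refl eq
  image-split []      (_ ∷ _) q ()
  image-split ((zero , b) ∷ Z) (x ∷ []) q eq with ∷-injective eq
  ... | refl , eq' = inside-0 [] Z b refl refl (sym eq')
  image-split ((zero , b) ∷ Z) (x ∷ y ∷ p) q eq with ∷-injective eq
  ... | refl , eq' with ∷-injective eq'
  ...   | refl , eq'' = ImageSplit-∷ (zero , b) refl (image-split Z p q eq'')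
  image-split ((suc j , b) ∷ Z) (x ∷ p) q eq rewrite ξ-suc j b with ∷-injective eq
  ... | refl , eq' = ImageSplit-∷ (suc j , b) (cong (_++ p) (ξ-suc j b)) (image-split Z p q eq')

  aligned-split : ∀ Z p q → ξs Z ≡ p ++ q → HeadNot1 q →
                  ∃₂ λ Z₁ Z₂ → Z ≡ Z₁ ++ Z₂ × ξs Z₁ ≡ p × ξs Z₂ ≡ q
  aligned-split Z p q eq h with image-split Z p q eq
  ... | aligned Z₁ Z₂ e e₁ e₂     = Z₁ , Z₂ , e , e₁ , e₂
  ... | inside-0 _ _ _ _ _ refl = contradiction refl h

  1-preceded-by-0 : ∀ Z p {c b s} → ξs Z ≡ p ++ c ∷ (1 , b) ∷ s → c ≡ (0 , b)
  1-preceded-by-0 Z p {c} {b} {s} eq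
    with image-split Z (p ++ c ∷ []) ((1 , b) ∷ s) (trans eq (sym (++-assoc p (c ∷ []) _)))
  ... | aligned _ Z₂ _ _ e₂ = contradiction e₂ (ξs≢1∷ Z₂)
  ... | inside-0 Z₁ _ _ _ e₁ refl = ∷ʳ-injectiveʳ p (ξs Z₁) e₁

  ξs-≡-∷ : ∀ Y {x r} → ξs Y ≡ x ∷ r → ∃₂ λ e Y' → Y ≡ e ∷ Y' × first e ≡ x
  ξs-≡-∷ []      ()
  ξs-≡-∷ (e ∷ Y) eq rewrite proj₂ (ξ-first e) = e , Y , refl , ∷-injectiveˡ eq

  ξs-≡-∷ʳ : ∀ Z p {x} → ξs Z ≡ p ++ x ∷ [] → ∃₂ λ Z₀ e → Z ≡ Z₀ ++ e ∷ [] × rot e ≡ x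
  ξs-≡-∷ʳ Z p eq with initLast Z
  ... | [] = case ++-conicalʳ p _ (sym eq) of λ ()
  ... | Z₀ ∷ʳ′ e with ξ-last e
  ...   | r , ξe = Z₀ , e , refl , ∷ʳ-injectiveʳ (ξs Z₀ ++ r) p (begin
            (ξs Z₀ ++ r) ++ rot e ∷ [] ≡⟨ ++-assoc (ξs Z₀) r _ ⟩
            ξs Z₀ ++ r ++ rot e ∷ []   ≡⟨ cong (ξs Z₀ ++_) (sym ξe) ⟩
            ξs Z₀ ++ ξ k e             ≡⟨ cong (ξs Z₀ ++_) (sym (++-identityʳ (ξ k e))) ⟩
            ξs Z₀ ++ ξs (e ∷ [])       ≡⟨ sym (ξs-++ Z₀ (e ∷ [])) ⟩
            ξs (Z₀ ++ e ∷ [])          ≡⟨ eq ⟩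
            p ++ _ ∷ []                ∎)
    where open ≡-Reasoning

  uPrefix : ℕ → List Letter
  uPrefix m = ξ^ k m w0

  uPrefix-suc : ∀ m → uPrefix (suc m) ≡ uPrefix m ++ ξ^ k m ((1 , false) ∷ [])
  uPrefix-suc zero    = refl
  uPrefix-suc (suc m) = trans (cong ξs (uPrefix-suc m)) (ξs-++ (uPrefix m) _)

  uPrefix-valid : ∀ m → All Valid (uPrefix m)
  uPrefix-valid zero    = s≤s z≤n ∷ []
  uPrefix-valid (suc m) = ξs-valid (uPrefix m)

  Occ : ℕ → List Letter → Set
  Occ m t = t ⊑ uPrefix m

  Factor : List Letter → Set
  Factor t = ∃ λ m → Occ m t

  Occ-suc : ∀ {m t} → Occ m t → Occ (suc m) t
  Occ-suc {m} o = subst (_ ⊑_) (sym (uPrefix-suc m)) (⊑-++ʳ _ o)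

  Factor-⊑ : ∀ {t u} → t ⊑ u → Factor u → Factor t
  Factor-⊑ t⊑u (m , o) = m , ⊑-trans t⊑u o

  Factor-suffix : ∀ {w t} → (∃ λ X → w ≡ X ++ t) → Factor w → Factor t
  Factor-suffix (X , refl) = Factor-⊑ (suffix-⊑ X _)

  Factor-valid : ∀ {t} → Factor t → All Valid t
  Factor-valid (m , o) = ⊑-All o (uPrefix-valid m)

  Covers : List Letter → List Letter → Set
  Covers Z v = ∃ λ r → ξs Z ≡ v ++ r

  desubstituteˡ : ∀ {a w} → HeadNot1 w → Factor (a ∷ w) →
                  ∃₂ λ e Z → rot e ≡ a × Covers Z w × Factor (e ∷ Z)
  desubstituteˡ {a} {w} h (m , o) with Occ-suc {m} o
  ... | p , s , eq
    with aligned-split (uPrefix m) (p ++ a ∷ []) (w ++ s)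
           (trans eq (sym (++-assoc p (a ∷ []) (w ++ s)))) (HeadNot1-++ w h)
  ... | Z₁ , Z₂ , split , e₁ , e₂ with ξs-≡-∷ʳ Z₁ p e₁
  ...   | Z₀ , e , refl , rot-e =
    e , Z₂ , rot-e , (s , e₂) ,
    (m , Z₀ , [] , trans split (trans (++-assoc Z₀ (e ∷ []) Z₂) (cong (Z₀ ++_) (sym (++-identityʳ (e ∷ Z₂))))))

  desubstituteʳ : ∀ {w s} → HeadNot1 (w ++ s) → HeadNot1 s → Factor (w ++ s) →
                  ∃₂ λ Z Y → ξs Z ≡ w × Covers Y s × Factor (Z ++ Y)
  desubstituteʳ {w} {s} h hs (m , o) with Occ-suc {m} o
  ... | p , r , eq
    with aligned-split (uPrefix m) p ((w ++ s) ++ r) eq (HeadNot1-++ (w ++ s) h)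
  ... | Z₁ , Z₂ , split , _ , e₂
    with aligned-split Z₂ w (s ++ r) (trans e₂ (++-assoc w s r)) (HeadNot1-++ s hs)
  ...   | Z , Y , refl , eZ , eY =
    Z , Y , eZ , (r , eY) , (m , Z₁ , [] , trans split (cong (Z₁ ++_) (sym (++-identityʳ (Z ++ Y)))))

  desubstituteʳ₁ : ∀ {w x} → HeadNot1 (w ++ x ∷ []) → proj₁ x ≢ 1 → Factor (w ++ x ∷ []) →
                   ∃₂ λ Z e → ξs Z ≡ w × first e ≡ x × Factor (Z ++ e ∷ [])
  desubstituteʳ₁ h x≢1 f with desubstituteʳ h x≢1 f
  ... | Z , Y , eZ , (r , eY) , fZY with ξs-≡-∷ Y eY
  ...   | e , Y' , refl , first-e = Z , e , eZ , first-e , Factor-⊑ (++-prefix-⊑ Z (e ∷ []) Y') fZY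

  Factor-valid-prefix : ∀ {Z Y} → Factor (Z ++ Y) → All Valid Z
  Factor-valid-prefix {Z} f = Allₚ.++⁻ˡ Z (Factor-valid f)

  desubstitute-image : ∀ {X x} → All Valid X → proj₁ x ≢ 1 → Factor (ξs X ++ x ∷ []) →
                       ∃ λ e → first e ≡ x × Factor (X ++ e ∷ [])
  desubstitute-image {X} vX x≢1 f with desubstituteʳ₁ (ξs-HeadNot1 X x≢1) x≢1 f
  ... | Z , e , eZ , first-e , fZe with ξs-injective (Factor-valid-prefix {Z} fZe) vX eZ
  ...   | refl = e , first-e , fZe

  EndsWith : List Letter → Letter → Set
  EndsWith w a = ∃ λ w₀ → w ≡ w₀ ++ a ∷ []

  EndsWith-unique : ∀ {w a a'} → EndsWith w a → EndsWith w a' → a ≡ a'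
  EndsWith-unique (w₀ , refl) (w₀' , eq) = ∷ʳ-injectiveʳ w₀ w₀' eq

  EndsWith-++ : ∀ X {w a} → EndsWith w a → EndsWith (X ++ w) a
  EndsWith-++ X (w₀ , refl) = X ++ w₀ , sym (++-assoc X w₀ _)

  EndsWith-⊑ : ∀ {w a} → EndsWith w a → ∀ t s → a ∷ t ⊑ w ++ t ++ s
  EndsWith-⊑ (w₀ , refl) t s = w₀ , s , ++-assoc w₀ _ (t ++ s)

  infix 4 _↝_

  data _↝_ : Letter → Letter → Set where
    ↝0   : ∀ {a} b → a ↝ (0 , b)
    ↝suc : ∀ {i b} → suc i < k → (i , b) ↝ (suc i , b)

  rot-↝-first : ∀ {e' e} → e' ↝ e → rot e' ↝ first e
  rot-↝-first (↝0 b) = ↝0 b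
  rot-↝-first (↝suc {i} {b} lt) rewrite rot-step {i} {b} lt with rot-view (suc i) b
  ... | step lt' eq rewrite eq = ↝suc lt'
  ... | wrap _   eq rewrite eq = ↝0 (not b)

  uPrefix0-no-pair : ∀ p {c d s} → uPrefix 0 ≢ p ++ c ∷ d ∷ s
  uPrefix0-no-pair []          ()
  uPrefix0-no-pair (_ ∷ [])    ()
  uPrefix0-no-pair (_ ∷ _ ∷ _) ()

  Occ-↝ : ∀ m {c d} → Occ m (c ∷ d ∷ []) → c ↝ d
  Occ-↝ zero (p , s , eq) = contradiction eq (uPrefix0-no-pair p)
  Occ-↝ (suc m) {c} {j , b} (p , s , eq) with j ≟ 1
  ... | yes refl rewrite 1-preceded-by-0 (uPrefix m) p eq = ↝suc (s≤s (s≤s z≤n))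
  ... | no j≢1
    with aligned-split (uPrefix m) (p ++ c ∷ []) ((j , b) ∷ s) (trans eq (sym (++-assoc p _ _))) j≢1
  ... | Z₁ , Z₂ , split , e₁ , e₂ with ξs-≡-∷ʳ Z₁ p e₁ | ξs-≡-∷ Z₂ e₂
  ...   | Z₀ , e' , refl , rot-e' | e , Z' , refl , first-e =
    subst₂ _↝_ rot-e' first-e
      (rot-↝-first (Occ-↝ m (Z₀ , Z' , trans split (++-assoc Z₀ (e' ∷ []) (e ∷ Z')))))

  Factor-↝ : ∀ {c d} → Factor (c ∷ d ∷ []) → c ↝ d
  Factor-↝ (m , o) = Occ-↝ m o

  Factor-last-↝ : ∀ {w a e} → EndsWith w a → Factor (w ++ e ∷ []) → a ↝ e
  Factor-last-↝ ends f = Factor-↝ (Factor-⊑ (EndsWith-⊑ ends (_ ∷ []) []) f)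

  ↝-pred : ∀ {a j c} → a ↝ (suc j , c) → a ≡ (j , c)
  ↝-pred (↝suc _) = refl

  ↝-πL : ∀ {i b u} → (i , b) ↝ u → πL u ≡ b → u ≡ (0 , b)
  ↝-πL (↝0 _)   refl = refl
  ↝-πL (↝suc _) eq   = contradiction eq not≢self

  ↝-first-0 : ∀ {i b e} → (i , b) ↝ e → first e ≡ (0 , b) → e ≡ (0 , b)
  ↝-first-0 (↝0 _) eq = eq
  ↝-first-0 (↝suc {i} {b} _) eq with rot-view (suc i) b
  ... | step _ e = case trans (sym e) eq of λ ()
  ... | wrap _ e = contradiction (,-injectiveʳ (trans (sym e) eq)) not≢self

  ↝-from-suc≢1 : ∀ {i b h} → (suc i , b) ↝ h → proj₁ h ≢ 1
  ↝-from-suc≢1 (↝0 _)   = λ ()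
  ↝-from-suc≢1 (↝suc _) = λ ()

  ξs-≡-0∷ : ∀ {Y b v} → All Valid Y → ξs Y ≡ (0 , b) ∷ v →
            (∃ λ Y' → Y ≡ (0 , b) ∷ Y' × v ≡ (1 , b) ∷ ξs Y') ⊎
            (∃ λ Y' → Y ≡ (top , not b) ∷ Y' × v ≡ ξs Y')
  ξs-≡-0∷ {Y} vY eq with ξs-≡-∷ Y eq
  ... | e , Y' , refl , first-e with first≡0 (All.head vY) first-e
  ...   | inj₁ refl = inj₁ (Y' , refl , sym (∷-injectiveʳ eq))
  ...   | inj₂ refl = inj₂ (Y' , refl , sym (∷-injectiveʳ (trans (cong (_++ ξs Y') (sym ξ-top)) eq)))

  pred-of-isolated-0 : ∀ {a b c} → Factor (a ∷ (0 , b) ∷ c ∷ []) → c ≢ (1 , b) → a ≡ (top , not b)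
  pred-of-isolated-0 f c≢1 with desubstituteˡ (λ ()) f
  ... | e , Z , refl , (r , cov) , fZ with ξs-≡-0∷ (All.tail (Factor-valid fZ)) cov
  ...   | inj₁ (_ , _ , eq) = contradiction (∷-injectiveˡ eq) c≢1
  ...   | inj₂ (Z' , refl , _) with ↝-pred (Factor-↝ (Factor-⊑ (++-prefix-⊑ [] (e ∷ _ ∷ []) Z') fZ))
  ...     | refl = rot-step ≤-refl

  pred-of-010 : ∀ {a b} → Factor (a ∷ (0 , b) ∷ (1 , b) ∷ (0 , b) ∷ []) → a ≡ (0 , b)
  pred-of-010 {b = b} f with desubstituteˡ (λ ()) f
  ... | e , Z , refl , (r , cov) , fZ with ξs-≡-0∷ (All.tail (Factor-valid fZ)) cov
  ...   | inj₂ (Z' , refl , eq) = contradiction (sym eq) (ξs≢1∷ Z')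
  ...   | inj₁ (Z' , refl , eq) with ξs-≡-∷ Z' (sym (∷-injectiveʳ eq))
  ...     | e₂ , Z'' , refl , first-e₂
    with pred-of-isolated-0 (Factor-⊑ (++-prefix-⊑ [] (e ∷ (0 , b) ∷ e₂ ∷ []) Z'') fZ)
                            (λ { refl → case first-e₂ of λ () })
  ...       | refl = trans rot-top (cong (0 ,_) (not-involutive b))

  -- The words ξ^ℓ (0 , c) and a family of forbidden words

  ramp : Bool → ℕ → List Letter
  ramp c zero    = (0 , c) ∷ []
  ramp c (suc m) = ramp c m ++ (suc m , c) ∷ []

  ramp-ends : ∀ c m → EndsWith (ramp c m) (m , c)
  ramp-ends c zero    = [] , refl
  ramp-ends c (suc m) = ramp c m , refl

  ramp-valid : ∀ {c m} → m < k → All Valid (ramp c m)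
  ramp-valid {m = zero}  lt = lt ∷ []
  ramp-valid {m = suc m} lt = Allₚ.++⁺ (ramp-valid (<-trans (n<1+n m) lt)) (lt ∷ [])

  ξs-ramp : ∀ {c m} → suc m < k → ξs (ramp c m) ≡ ramp c (suc m)
  ξs-ramp {m = zero}  _  = refl
  ξs-ramp {c} {suc m} lt = begin
    ξs (ramp c m ++ (suc m , c) ∷ [])         ≡⟨ ξs-++ (ramp c m) _ ⟩
    ξs (ramp c m) ++ ξ k (suc m , c) ++ []    ≡⟨ cong₂ _++_ (ξs-ramp (<-trans (n<1+n _) lt)) (++-identityʳ _) ⟩
    ramp c (suc m) ++ ξ k (suc m , c)         ≡⟨ cong (ramp c (suc m) ++_) (ξ-suc m c) ⟩
    ramp c (suc m) ++ rot (suc m , c) ∷ []    ≡⟨ cong (λ a → ramp c (suc m) ++ a ∷ []) (rot-step lt) ⟩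
    ramp c (suc m) ++ (suc (suc m) , c) ∷ []  ∎
    where open ≡-Reasoning

  ξ^-valid : ∀ i {X} → All Valid X → All Valid (ξ^ k i X)
  ξ^-valid zero    vX = vX
  ξ^-valid (suc i) {X} _ = ξs-valid (ξ^ k i X)

  -- ξ^(suc i) (top , c) = ramp (not c) i, so desubstitution maps forbidden c (suc i) to
  -- forbidden c i, and forbidden c 0 is excluded by pred-of-010.
  forbidden : Bool → ℕ → List Letter
  forbidden c i = ξ^ k i ((top , c) ∷ []) ++ ramp (not c) (suc i) ++ (0 , not c) ∷ []

  forbidden-suc-image : ∀ c i → suc (suc i) < k →
    forbidden c (suc i) ≡ ξs (ξ^ k i ((top , c) ∷ []) ++ ramp (not c) (suc i)) ++ (0 , not c) ∷ []
  forbidden-suc-image c i lt = begin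
    ξs A ++ ramp (not c) (suc (suc i)) ++ z ≡⟨ cong (λ r → ξs A ++ r ++ z) (sym (ξs-ramp lt)) ⟩
    ξs A ++ ξs R ++ z                       ≡⟨ sym (++-assoc (ξs A) (ξs R) z) ⟩
    (ξs A ++ ξs R) ++ z                     ≡⟨ cong (_++ z) (sym (ξs-++ A R)) ⟩
    ξs (A ++ R) ++ z                        ∎
    where
      open ≡-Reasoning
      A R z : List Letter
      A = ξ^ k i ((top , c) ∷ [])
      R = ramp (not c) (suc i)
      z = (0 , not c) ∷ []

  forbidden-lift : ∀ c i → suc (suc i) < k → Factor (forbidden c (suc i)) → Factor (forbidden c i)
  forbidden-lift c i lt f = lift (desubstitute-image vX (λ ()) (subst Factor (forbidden-suc-image c i lt) f))
    where
      A R : List Letter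
      A = ξ^ k i ((top , c) ∷ [])
      R = ramp (not c) (suc i)
      vX : All Valid (A ++ R)
      vX = Allₚ.++⁺ (ξ^-valid i (≤-refl ∷ [])) (ramp-valid (<-trans (n<1+n _) lt))
      lift : (∃ λ e → first e ≡ (0 , not c) × Factor ((A ++ R) ++ e ∷ [])) → Factor (forbidden c i)
      lift (e , first-e , fXe) =
        subst Factor (++-assoc A R _)
          (subst (λ e → Factor ((A ++ R) ++ e ∷ []))
                 (↝-first-0 (Factor-last-↝ (EndsWith-++ A (ramp-ends (not c) (suc i))) fXe) first-e) fXe)

  forbidden-not-factor : ∀ c i → suc i < k → ¬ Factor (forbidden c i)
  forbidden-not-factor c zero    _  f = case pred-of-010 f of λ ()
  forbidden-not-factor c (suc i) lt f = forbidden-not-factor c i (<-trans (n<1+n _) lt) (forbidden-lift c i lt f)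

  ξ^-++ : ∀ i X Y → ξ^ k i (X ++ Y) ≡ ξ^ k i X ++ ξ^ k i Y
  ξ^-++ zero    X Y = refl
  ξ^-++ (suc i) X Y = trans (cong ξs (ξ^-++ i X Y)) (ξs-++ (ξ^ k i X) (ξ^ k i Y))

  ξ^-+ : ∀ i j X → ξ^ k (i + j) X ≡ ξ^ k i (ξ^ k j X)
  ξ^-+ zero    j X = refl
  ξ^-+ (suc i) j X = cong ξs (ξ^-+ i j X)

  imageOf0 : Bool → ℕ → List Letter
  imageOf0 c ℓ = ξ^ k ℓ ((0 , c) ∷ [])

  imageOf0-ramp : ∀ {c m} → m < k → imageOf0 c m ≡ ramp c m
  imageOf0-ramp {m = zero}  _  = refl
  imageOf0-ramp {m = suc m} lt = trans (cong ξs (imageOf0-ramp (<-trans (n<1+n m) lt))) (ξs-ramp lt)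

  imageOf0-k : ∀ {c} → imageOf0 c k ≡ ramp c top ++ (0 , not c) ∷ []
  imageOf0-k {c} = begin
    ξs (imageOf0 c top)                      ≡⟨ cong ξs (imageOf0-ramp ≤-refl) ⟩
    ξs (ramp c (2 + n) ++ (top , c) ∷ [])    ≡⟨ ξs-++ (ramp c (2 + n)) _ ⟩
    ξs (ramp c (2 + n)) ++ ξ k (top , c) ++ [] ≡⟨ cong₂ _++_ (ξs-ramp ≤-refl) (trans (++-identityʳ _) ξ-top) ⟩
    ramp c top ++ (0 , not c) ∷ []           ∎
    where open ≡-Reasoning

  imageOf0-above-k : ∀ {c m} → m < k →
    ∃ λ X → imageOf0 c (m + k) ≡ X ++ ξ^ k m ((top , c) ∷ []) ++ ramp (not c) m
  imageOf0-above-k {c} {m} lt = ξ^ k m R , (begin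
    imageOf0 c (m + k)                         ≡⟨ ξ^-+ m k _ ⟩
    ξ^ k m (imageOf0 c k)                      ≡⟨ cong (ξ^ k m) imageOf0-k ⟩
    ξ^ k m ((R ++ T) ++ Z)                     ≡⟨ cong (ξ^ k m) (++-assoc R T Z) ⟩
    ξ^ k m (R ++ T ++ Z)                       ≡⟨ ξ^-++ m R (T ++ Z) ⟩
    ξ^ k m R ++ ξ^ k m (T ++ Z)                ≡⟨ cong (ξ^ k m R ++_) (ξ^-++ m T Z) ⟩
    ξ^ k m R ++ ξ^ k m T ++ imageOf0 (not c) m ≡⟨ cong (λ r → ξ^ k m R ++ ξ^ k m T ++ r) (imageOf0-ramp lt) ⟩
    ξ^ k m R ++ ξ^ k m T ++ ramp (not c) m     ∎)
    where
      open ≡-Reasoning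
      R T Z : List Letter
      R = ramp c (2 + n)
      T = (top , c) ∷ []
      Z = (0 , not c) ∷ []

  imageOf0-ends-below-k : ∀ {c ℓ} → ℓ < k → EndsWith (imageOf0 c ℓ) (ℓ , c)
  imageOf0-ends-below-k {c} {ℓ} lt = subst (λ w → EndsWith w (ℓ , c)) (sym (imageOf0-ramp lt)) (ramp-ends c ℓ)

  imageOf0-ends-above-k : ∀ {c m} → m < k → EndsWith (imageOf0 c (m + k)) (m , not c)
  imageOf0-ends-above-k {c} {m} lt with imageOf0-above-k {c} lt
  ... | X , eq = subst (λ w → EndsWith w (m , not c)) (sym eq)
                   (EndsWith-++ X (EndsWith-++ (ξ^ k m _) (ramp-ends (not c) m)))

  imageOf0-forbidden : ∀ {c m} → m < top →
    ∃ λ X → imageOf0 c (m + k) ++ (suc m , not c) ∷ (0 , not c) ∷ [] ≡ X ++ forbidden c m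
  imageOf0-forbidden {c} {m} lt with imageOf0-above-k {c} (<-trans lt ≤-refl)
  ... | X , eq = X , (begin
    imageOf0 c (m + k) ++ s ∷ z       ≡⟨ cong (_++ s ∷ z) eq ⟩
    (X ++ A ++ R) ++ s ∷ z            ≡⟨ ++-assoc X (A ++ R) (s ∷ z) ⟩
    X ++ (A ++ R) ++ s ∷ z            ≡⟨ cong (X ++_) (++-assoc A R (s ∷ z)) ⟩
    X ++ A ++ R ++ s ∷ z              ≡⟨ cong (λ r → X ++ A ++ r) (sym (++-assoc R (s ∷ []) z)) ⟩
    X ++ A ++ (R ++ s ∷ []) ++ z      ∎)
    where
      open ≡-Reasoning
      A R z : List Letter
      A = ξ^ k m ((top , c) ∷ [])
      R = ramp (not c) m
      z = (0 , not c) ∷ []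
      s : Letter
      s = (suc m , not c)

  -- ℓ < top + k is the bound ℓ ≤ 2k - 2.
  ImageOf0 : List Letter → Set
  ImageOf0 w = ∃₂ λ ℓ c → ℓ < top + k × ℓ ≢ top × w ≡ imageOf0 c ℓ

  above-k-view : ∀ {ℓ} → k ≤ ℓ → ℓ < top + k → ∃ λ m → m < top × ℓ ≡ m + k
  above-k-view {ℓ} k≤ℓ bound =
    ℓ ∸ k , +-cancelʳ-< k (ℓ ∸ k) top (subst (_< top + k) (sym ℓ≡) bound) , sym ℓ≡
    where
      ℓ≡ : ℓ ∸ k + k ≡ ℓ
      ℓ≡ = m∸n+n≡m k≤ℓ

  level-view : ∀ {ℓ} → ℓ < top + k → ℓ ≢ top → ℓ < top ⊎ ∃ λ m → m < top × ℓ ≡ m + k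
  level-view {ℓ} bound ℓ≢top with ℓ <? top
  ... | yes lt = inj₁ lt
  ... | no ¬lt = inj₂ (above-k-view (≤∧≢⇒< (≮⇒≥ ¬lt) (ℓ≢top ∘ sym)) bound)

  ImageOf0-ξs : ∀ {Z j b} → ImageOf0 Z → EndsWith (ξs Z) (j , b) → j ≢ top → ImageOf0 (ξs Z)
  ImageOf0-ξs {j = j} (ℓ , c , bound , _ , refl) ends j≢top =
    suc ℓ , c , ≤∧≢⇒< bound (last-not-top (top + k) (imageOf0-ends-above-k {c} {top} ≤-refl)) ,
    last-not-top top (imageOf0-ends-below-k {c} {top} ≤-refl) , refl
    where
      last-not-top : ∀ ℓ' {c'} → EndsWith (imageOf0 c ℓ') (top , c') → suc ℓ ≢ ℓ'
      last-not-top _ ends' refl = j≢top (,-injectiveˡ (EndsWith-unique ends ends'))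

  followed-by-top-below-k : ∀ {ℓ c b} → ℓ < top → Factor (imageOf0 c ℓ ++ (top , not b) ∷ []) →
                            ξs (imageOf0 c ℓ) ++ (0 , b) ∷ [] ≡ imageOf0 (not b) k
  followed-by-top-below-k {ℓ} {c} {b} lt f
    with ↝-pred (Factor-last-↝ (imageOf0-ends-below-k {c} {ℓ} (<-trans lt ≤-refl)) f)
  ... | refl = begin
    ξs (imageOf0 (not b) (2 + n)) ++ (0 , b) ∷ [] ≡⟨ cong (_++ _) (imageOf0-ramp {not b} {top} ≤-refl) ⟩
    ramp (not b) top ++ (0 , b) ∷ []              ≡⟨ cong (λ b' → ramp (not b) top ++ (0 , b') ∷ [])
                                                           (sym (not-involutive b)) ⟩
    ramp (not b) top ++ (0 , not (not b)) ∷ []    ≡⟨ sym imageOf0-k ⟩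
    imageOf0 (not b) k                            ∎
    where open ≡-Reasoning

  ¬followed-by-top-above-k : ∀ {m c b} → m < top →
                             ¬ Factor (imageOf0 c (m + k) ++ (top , not b) ∷ (0 , not b) ∷ [])
  ¬followed-by-top-above-k {m} {c} {b} lt f =
    forbidden-not-factor c (2 + n) ≤-refl (Factor-suffix (imageOf0-forbidden {c} {2 + n} ≤-refl) f')
    where
      pred≡ : (m , not c) ≡ (2 + n , not b)
      pred≡ = ↝-pred (Factor-last-↝ (imageOf0-ends-above-k {c} {m} (<-trans lt ≤-refl))
                (Factor-⊑ (++-prefix-⊑ (imageOf0 c (m + k)) ((top , not b) ∷ []) ((0 , not b) ∷ [])) f))
      f' : Factor (imageOf0 c (2 + n + k) ++ (top , not c) ∷ (0 , not c) ∷ [])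
      f' = subst₂ (λ m' b' → Factor (imageOf0 c (m' + k) ++ (top , b') ∷ (0 , b') ∷ []))
                  (,-injectiveˡ pred≡) (sym (,-injectiveʳ pred≡)) f

  ImageOf0-followed-by-top : ∀ {Z b} → ImageOf0 Z → Factor (Z ++ (top , not b) ∷ (0 , not b) ∷ []) →
                             ξs Z ++ (0 , b) ∷ [] ≡ imageOf0 (not b) k
  ImageOf0-followed-by-top {b = b} (ℓ , c , bound , ℓ≢top , refl) f with level-view bound ℓ≢top
  ... | inj₁ lt              =
    followed-by-top-below-k lt (Factor-⊑ (++-prefix-⊑ (imageOf0 c ℓ) ((top , not b) ∷ []) ((0 , not b) ∷ [])) f)
  ... | inj₂ (m , lt , refl) = contradiction f (¬followed-by-top-above-k lt)

  -- Special factors with a π-ambiguous right extension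

  LeftSpecial : List Letter → Set
  LeftSpecial w = ∃₂ λ a a' → a ≢ a' × Factor (a ∷ w) × Factor (a' ∷ w)

  RightSpecialπ : List Letter → Set
  RightSpecialπ w = ∃₂ λ x y → x ≢ y × πL x ≡ πL y × Factor (w ++ x ∷ []) × Factor (w ++ y ∷ [])

  leftSpecial-head : ∀ {w} → w ≢ [] → LeftSpecial w → ∃₂ λ c t → w ≡ (0 , c) ∷ t
  leftSpecial-head {[]}              w≢[] _ = contradiction refl w≢[]
  leftSpecial-head {(zero , c) ∷ t}  _    _ = c , t , refl
  leftSpecial-head {(suc j , c) ∷ t} _    (a , a' , a≢a' , fa , fa') =
    contradiction (trans (pred-of fa) (sym (pred-of fa'))) a≢a'
    where
      pred-of : ∀ {a} → Factor (a ∷ (suc j , c) ∷ t) → a ≡ (j , c)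
      pred-of {a} f = ↝-pred (Factor-↝ (Factor-⊑ (++-prefix-⊑ [] (a ∷ (suc j , c) ∷ []) t) f))

  data Fork (j : ℕ) (b : Bool) : Letter → Letter → Set where
    straight : Fork j b (suc j , b) (0 , not b)
    swapped  : Fork j b (0 , not b) (suc j , b)

  fork-of-↝ : ∀ {j b x y} → (j , b) ↝ x → (j , b) ↝ y → x ≢ y → πL x ≡ πL y → suc j < k × Fork j b x y
  fork-of-↝ (↝0 _)    (↝0 _)    x≢y refl = contradiction refl x≢y
  fork-of-↝ (↝0 _)    (↝suc lt) _   refl = lt , swapped
  fork-of-↝ (↝suc lt) (↝0 _)    _   refl = lt , straight
  fork-of-↝ (↝suc _)  (↝suc _)  x≢y _    = contradiction refl x≢y

  right-fork : ∀ {w x y} → w ≢ [] → x ≢ y → πL x ≡ πL y → Factor (w ++ x ∷ []) → Factor (w ++ y ∷ []) →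
               ∃₂ λ j b → EndsWith w (j , b) × suc j < k × Fork j b x y
  right-fork {w} w≢[] x≢y πxy fx fy with initLast w
  ... | []            = contradiction refl w≢[]
  ... | w₀ ∷ʳ′ (j , b) =
    j , b , (w₀ , refl) , fork-of-↝ (Factor-last-↝ (w₀ , refl) fx) (Factor-last-↝ (w₀ , refl) fy) x≢y πxy

  Fork-factors : ∀ {w j b x y} → Fork j b x y → Factor (w ++ x ∷ []) → Factor (w ++ y ∷ []) →
                 Factor (w ++ (suc j , b) ∷ []) × Factor (w ++ (0 , not b) ∷ [])
  Fork-factors straight fx fy = fx , fy
  Fork-factors swapped fx fy = fy , fx

  rightSpecialπ-preimage : ∀ {w x y} → HeadNot1 w → proj₁ x ≢ 1 → proj₁ y ≢ 1 → x ≢ y → πL x ≡ πL y →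
    Factor (w ++ x ∷ []) → Factor (w ++ y ∷ []) → ∃ λ Z → ξs Z ≡ w × RightSpecialπ Z
  rightSpecialπ-preimage {w} {x} {y} h x≢1 y≢1 x≢y πxy fx fy =
    combine (desubstituteʳ₁ (HeadNot1-++ w h) x≢1 fx) (desubstituteʳ₁ (HeadNot1-++ w h) y≢1 fy)
    where
      Lifted : Letter → Set
      Lifted z = ∃₂ λ Z e → ξs Z ≡ w × first e ≡ z × Factor (Z ++ e ∷ [])
      combine : Lifted x → Lifted y → ∃ λ Z → ξs Z ≡ w × RightSpecialπ Z
      combine (Z , e , eZ , first-e , fe) (Z' , e' , eZ' , first-e' , fe')
        with ξs-injective (Factor-valid-prefix {Z'} fe') (Factor-valid-prefix {Z} fe) (trans eZ' (sym eZ))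
      ... | refl = Z , eZ , e , e' , e≢e' , πee' , fe , fe'
        where
          e≢e' : e ≢ e'
          e≢e' eq = x≢y (trans (sym first-e) (trans (cong first eq) first-e'))
          πee' : πL e ≡ πL e'
          πee' = begin
            πL e         ≡⟨ sym (πL-first e) ⟩
            πL (first e) ≡⟨ cong πL first-e ⟩
            πL x         ≡⟨ πxy ⟩
            πL y         ≡⟨ cong πL (sym first-e') ⟩
            πL (first e') ≡⟨ πL-first e' ⟩
            πL e'        ∎
            where open ≡-Reasoning

  leftExtension-preimage : ∀ {Z h a} → All Valid Z → proj₁ h ≢ 1 → Factor (a ∷ ξs Z ++ h ∷ []) →
                           ∃ λ e → rot e ≡ a × Factor (e ∷ Z)
  leftExtension-preimage {Z} {h} {a} vZ h≢1 f = lift (desubstituteˡ (ξs-HeadNot1 Z h≢1) f)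
    where
      lift : (∃₂ λ e Z' → rot e ≡ a × Covers Z' (ξs Z ++ h ∷ []) × Factor (e ∷ Z')) →
             ∃ λ e → rot e ≡ a × Factor (e ∷ Z)
      lift (e , Z' , rot-e , (r , cov) , fZ')
        with aligned-split Z' (ξs Z) (h ∷ r) (trans cov (++-assoc (ξs Z) (h ∷ []) r)) h≢1
      ... | Z₁ , Z₂ , refl , e₁ , _ with ξs-injective (Allₚ.++⁻ˡ Z₁ (All.tail (Factor-valid fZ'))) vZ e₁
      ...   | refl = e , rot-e , Factor-⊑ (prefix-⊑ (e ∷ Z) Z₂) fZ'

  leftSpecial-preimage : ∀ {w Z} → (∀ {a} → Factor (a ∷ w) → ∃ λ e → rot e ≡ a × Factor (e ∷ Z)) →
                         LeftSpecial w → LeftSpecial Z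
  leftSpecial-preimage lift (a , a' , a≢a' , fa , fa') with lift fa | lift fa'
  ... | e , refl , fe | e' , refl , fe' = e , e' , (λ { refl → a≢a' refl }) , fe , fe'

  ξ^-nonempty : ∀ i a X → ∃₂ λ h r → ξ^ k i (a ∷ X) ≡ h ∷ r
  ξ^-nonempty zero    a X = a , X , refl
  ξ^-nonempty (suc i) a X with ξ^-nonempty i a X
  ... | h , r , eq rewrite eq | proj₂ (ξ-first h) = first h , _ , refl

  Factor-extendʳ : ∀ {t} → Factor t → ∃ λ x → Factor (t ++ x ∷ [])
  Factor-extendʳ     (m , p , x ∷ s , eq) = x , m , ∷ʳ-⊑ p x s eq
  Factor-extendʳ {t} (m , p , []    , eq) with ξ^-nonempty m (1 , false) []
  ... | h , r , eD = h , suc m , ∷ʳ-⊑ p h r (begin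
    uPrefix (suc m)                          ≡⟨ uPrefix-suc m ⟩
    uPrefix m ++ ξ^ k m ((1 , false) ∷ [])   ≡⟨ cong₂ _++_ eq eD ⟩
    (p ++ t ++ []) ++ h ∷ r                  ≡⟨ ++-assoc p (t ++ []) (h ∷ r) ⟩
    p ++ (t ++ []) ++ h ∷ r                  ≡⟨ cong (p ++_) (++-assoc t [] (h ∷ r)) ⟩
    p ++ t ++ h ∷ r                          ∎)
    where open ≡-Reasoning

  special-preimage-suc : ∀ {w i b x y} → HeadNot1 w → EndsWith w (suc i , b) →
    proj₁ x ≢ 1 → proj₁ y ≢ 1 → x ≢ y → πL x ≡ πL y → Factor (w ++ x ∷ []) → Factor (w ++ y ∷ []) →
    LeftSpecial w → ∃ λ Z → ξs Z ≡ w × LeftSpecial Z × RightSpecialπ Z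
  special-preimage-suc {w} h ends x≢1 y≢1 x≢y πxy fx fy ls =
    add-left (rightSpecialπ-preimage h x≢1 y≢1 x≢y πxy fx fy)
    where
      lift : ∀ {Z a} → All Valid Z → ξs Z ≡ w → Factor (a ∷ w) → ∃ λ e → rot e ≡ a × Factor (e ∷ Z)
      lift {Z} {a} vZ refl f =
        let (h , fh) = Factor-extendʳ f
        in leftExtension-preimage vZ (↝-from-suc≢1 (Factor-last-↝ (EndsWith-++ (a ∷ []) ends) fh)) fh
      add-left : (∃ λ Z → ξs Z ≡ w × RightSpecialπ Z) → ∃ λ Z → ξs Z ≡ w × LeftSpecial Z × RightSpecialπ Z
      add-left (Z , eZ , rs@(_ , _ , _ , _ , fZx , _)) =
        Z , eZ , leftSpecial-preimage (lift (Factor-valid-prefix {Z} fZx) eZ) ls , rs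

  preimage-before-01 : ∀ {w₀ b} → HeadNot1 w₀ → Factor (w₀ ++ (0 , b) ∷ (1 , b) ∷ []) →
                       ∃ λ Z → ξs Z ≡ w₀ × Factor (Z ++ (0 , b) ∷ [])
  preimage-before-01 {w₀} {b} h f = lift (desubstituteʳ (HeadNot1-++ w₀ h) (λ ()) f)
    where
      lift : (∃₂ λ Z Y → ξs Z ≡ w₀ × Covers Y ((0 , b) ∷ (1 , b) ∷ []) × Factor (Z ++ Y)) →
             ∃ λ Z → ξs Z ≡ w₀ × Factor (Z ++ (0 , b) ∷ [])
      lift (Z , Y , eZ , (r , eY) , fZY) with ξs-≡-0∷ (Allₚ.++⁻ʳ Z (Factor-valid fZY)) eY
      ... | inj₁ (Y' , refl , _)  = Z , eZ , Factor-⊑ (++-prefix-⊑ Z _ Y') fZY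
      ... | inj₂ (Y' , refl , eq) = contradiction (sym eq) (ξs≢1∷ Y')

  preimage-before-00 : ∀ {w₀ b} → HeadNot1 w₀ → Factor (w₀ ++ (0 , b) ∷ (0 , not b) ∷ []) →
                       ∃ λ Z → ξs Z ≡ w₀ × Factor (Z ++ (top , not b) ∷ (0 , not b) ∷ [])
  preimage-before-00 {w₀} {b} h f = lift (desubstituteʳ (HeadNot1-++ w₀ h) (λ ()) f)
    where
      lift : (∃₂ λ Z Y → ξs Z ≡ w₀ × Covers Y ((0 , b) ∷ (0 , not b) ∷ []) × Factor (Z ++ Y)) →
             ∃ λ Z → ξs Z ≡ w₀ × Factor (Z ++ (top , not b) ∷ (0 , not b) ∷ [])
      lift (Z , Y , eZ , (r , eY) , fZY) with ξs-≡-0∷ (Allₚ.++⁻ʳ Z (Factor-valid fZY)) eY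
      ... | inj₁ (_ , _ , eq)     = case ,-injectiveˡ (∷-injectiveˡ eq) of λ ()
      ... | inj₂ (Y' , refl , eq) with ξs-≡-∷ Y' (sym eq)
      ...   | e , Y'' , refl , first-e
        with ↝-first-0 (Factor-↝ (Factor-⊑ (Z , Y'' , refl) fZY)) first-e
      ...     | refl = Z , eZ , Factor-⊑ (++-prefix-⊑ Z _ Y'') fZY

  special-preimage-0 : ∀ {w₀ b} → HeadNot1 w₀ →
    Factor (w₀ ++ (0 , b) ∷ (1 , b) ∷ []) → Factor (w₀ ++ (0 , b) ∷ (0 , not b) ∷ []) →
    LeftSpecial (w₀ ++ (0 , b) ∷ []) →
    ∃ λ Z → ξs Z ≡ w₀ × LeftSpecial Z × Factor (Z ++ (0 , b) ∷ []) ×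
            Factor (Z ++ (top , not b) ∷ (0 , not b) ∷ [])
  special-preimage-0 {w₀} {b} h fx fy ls = combine (preimage-before-01 h fx) (preimage-before-00 h fy)
    where
      combine : (∃ λ Z → ξs Z ≡ w₀ × Factor (Z ++ (0 , b) ∷ [])) →
                (∃ λ Z → ξs Z ≡ w₀ × Factor (Z ++ (top , not b) ∷ (0 , not b) ∷ [])) →
                ∃ λ Z → ξs Z ≡ w₀ × LeftSpecial Z × Factor (Z ++ (0 , b) ∷ []) ×
                        Factor (Z ++ (top , not b) ∷ (0 , not b) ∷ [])
      combine (Z , refl , f0) (Z' , eZ' , fT) =
        Z , refl , leftSpecial-preimage (leftExtension-preimage vZ (λ ())) ls , f0 ,
        subst (λ X → Factor (X ++ _)) Z'≡Z fT
        where
          vZ : All Valid Z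
          vZ = Factor-valid-prefix {Z} f0
          Z'≡Z : Z' ≡ Z
          Z'≡Z = ξs-injective (Factor-valid-prefix {Z'} fT) vZ eZ'

  ξs-length : ∀ Z → length Z ≤ length (ξs Z)
  ξs-length []      = z≤n
  ξs-length (a ∷ Z) with ξ-first a
  ... | r , eq rewrite eq = s≤s (≤-trans (ξs-length Z) (length-++-≤ʳ (ξs Z) {r}))

  preimage-shorter : ∀ {Z N} → length (ξs Z) ≤ suc N → Z ≢ [] → LeftSpecial Z → length Z ≤ N
  preimage-shorter {Z} len Z≢[] ls with leftSpecial-head Z≢[] ls
  ... | c , t , refl = s≤s⁻¹ (≤-trans (s≤s (s≤s (ξs-length t))) len)

  HeadNot1-preimage-≢[] : ∀ {Z} → HeadNot1 (ξs Z) → Z ≢ []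
  HeadNot1-preimage-≢[] h refl = h

  leftSpecial-HeadNot1 : ∀ {w} → w ≢ [] → LeftSpecial w → HeadNot1 w
  leftSpecial-HeadNot1 w≢[] ls with leftSpecial-head w≢[] ls
  ... | c , t , refl = λ ()

  SpecialIsImageOf0 : ℕ → Set
  SpecialIsImageOf0 N = ∀ {w} → length w ≤ N → w ≢ [] → LeftSpecial w → RightSpecialπ w → ImageOf0 w

  special-ending-suc : ∀ {N w i b} → SpecialIsImageOf0 N → length w ≤ suc N →
    HeadNot1 w → EndsWith w (suc i , b) →
    suc (suc i) < k → Factor (w ++ (suc (suc i) , b) ∷ []) → Factor (w ++ (0 , not b) ∷ []) →
    LeftSpecial w → ImageOf0 w
  special-ending-suc {w = w} IH len h ends lt fx fy ls =
    finish (special-preimage-suc h ends (λ ()) (λ ()) (λ ()) refl fx fy ls)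
    where
      finish : (∃ λ Z → ξs Z ≡ w × LeftSpecial Z × RightSpecialπ Z) → ImageOf0 w
      finish (Z , refl , lsZ , rsZ) =
        ImageOf0-ξs (IH (preimage-shorter len Z≢[] lsZ) Z≢[] lsZ rsZ) ends (<⇒≢ (s≤s⁻¹ lt))
        where
          Z≢[] : Z ≢ []
          Z≢[] = HeadNot1-preimage-≢[] h

  special-ending-0 : ∀ {N w w₀ b} → SpecialIsImageOf0 N → length w ≤ suc N →
    w ≡ w₀ ++ (0 , b) ∷ [] → HeadNot1 w₀ →
    Factor (w ++ (1 , b) ∷ []) → Factor (w ++ (0 , not b) ∷ []) → LeftSpecial w → ImageOf0 w
  special-ending-0 {w₀ = w₀} {b} IH len refl h fx fy ls =
    finish (special-preimage-0 h (subst Factor (++-assoc w₀ _ _) fx) (subst Factor (++-assoc w₀ _ _) fy) ls)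
    where
      finish : (∃ λ Z → ξs Z ≡ w₀ × LeftSpecial Z × Factor (Z ++ (0 , b) ∷ []) ×
                        Factor (Z ++ (top , not b) ∷ (0 , not b) ∷ [])) → ImageOf0 (w₀ ++ (0 , b) ∷ [])
      finish (Z , refl , lsZ , f0 , fT) =
        k , not b , s≤s (m≤n+m k (2 + n)) , >⇒≢ ≤-refl , ImageOf0-followed-by-top (IH shorter Z≢[] lsZ rsZ) fT
        where
          Z≢[] : Z ≢ []
          Z≢[] = HeadNot1-preimage-≢[] h
          shorter : length Z ≤ _
          shorter = preimage-shorter (≤-trans (length-++-≤ˡ (ξs Z)) len) Z≢[] lsZ
          rsZ : RightSpecialπ Z
          rsZ = (0 , b) , (top , not b) , (λ ()) , sym (not-involutive b) , f0 ,
                Factor-⊑ (++-prefix-⊑ Z ((top , not b) ∷ []) ((0 , not b) ∷ [])) fT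

  special-isImageOf0 : ∀ N → SpecialIsImageOf0 N
  special-isImageOf0 zero    {[]}    _  w≢[] = contradiction refl w≢[]
  special-isImageOf0 zero    {_ ∷ _} ()
  special-isImageOf0 (suc N) {w} len w≢[] ls (x , y , x≢y , πxy , fx , fy) =
    by-fork (leftSpecial-HeadNot1 w≢[] ls) (right-fork w≢[] x≢y πxy fx fy)
    where
      by-fork : HeadNot1 w → (∃₂ λ j b → EndsWith w (j , b) × suc j < k × Fork j b x y) → ImageOf0 w
      by-fork hw (suc i , b , ends , lt , frk) =
        special-ending-suc (special-isImageOf0 N) len hw ends lt
          (proj₁ (Fork-factors frk fx fy)) (proj₂ (Fork-factors frk fx fy)) ls
      by-fork hw (zero , b , ([] , eq) , _ , _) = 0 , b , s≤s z≤n , (λ ()) , eq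
      by-fork hw (zero , b , (a ∷ w₁ , eq) , _ , frk) =
        special-ending-0 (special-isImageOf0 N) len eq (subst HeadNot1 eq hw)
          (proj₁ (Fork-factors frk fx fy)) (proj₂ (Fork-factors frk fx fy)) ls

  -- Lengths of the π-ambiguous extensions

  fork-next-letters : ∀ {j b u₁ v₁} → suc j < k →
    Factor ((j , b) ∷ (suc j , b) ∷ u₁ ∷ []) → Factor ((j , b) ∷ (0 , not b) ∷ v₁ ∷ []) →
    πL u₁ ≡ πL v₁ → u₁ ≡ (0 , b) × v₁ ≡ (1 , not b)
  fork-next-letters {j} {b} {u₁} {v₁} lt fu fv πuv = u₁≡ , v₁≡
    where
      v₁≡ : v₁ ≡ (1 , not b)
      v₁≡ = case v₁ ≟L (1 , not b) of λ where
        (yes eq)  → eq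
        (no v₁≢) → contradiction (cong suc (,-injectiveˡ (pred-of-isolated-0 fv v₁≢))) (<⇒≢ lt)
      u₁≡ : u₁ ≡ (0 , b)
      u₁≡ = ↝-πL (Factor-↝ (Factor-⊑ (suffix-⊑ ((j , b) ∷ []) _) fu))
                 (trans πuv (trans (cong πL v₁≡) (not-involutive b)))

  πL-after-01 : ∀ {j b v₂} → (1 , not b) ↝ v₂ → Factor ((j , b) ∷ (0 , not b) ∷ (1 , not b) ∷ v₂ ∷ []) →
                πL v₂ ≡ b
  πL-after-01 {b = b} (↝0 _)   f =
    trans (¬-not (λ { refl → not-¬ refl (,-injectiveʳ (pred-of-010 f)) })) (not-involutive b)
  πL-after-01 {b = b} (↝suc _) _ = not-involutive b

  fork-differs-within-2 : ∀ {j b u₁ u₂ v₁ v₂} → suc j < k →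
    Factor ((j , b) ∷ (suc j , b) ∷ u₁ ∷ u₂ ∷ []) → Factor ((j , b) ∷ (0 , not b) ∷ v₁ ∷ v₂ ∷ []) →
    πL u₁ ≡ πL v₁ → πL u₂ ≡ πL v₂ → ⊥
  fork-differs-within-2 {j} {b} {u₁} {u₂} {v₁} {v₂} lt fu fv π₁ π₂
    with fork-next-letters lt (Factor-⊑ (prefix-⊑ _ (u₂ ∷ [])) fu) (Factor-⊑ (prefix-⊑ _ (v₂ ∷ [])) fv) π₁
  ... | refl , refl =
    not-¬ refl (,-injectiveʳ (pred-of-isolated-0 (subst (λ u → Factor (_ ∷ _ ∷ u ∷ [])) u₂≡ fu') (λ ())))
    where
      fu' : Factor ((suc j , b) ∷ (0 , b) ∷ u₂ ∷ [])
      fu' = Factor-⊑ (suffix-⊑ ((j , b) ∷ []) _) fu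
      πv₂ : πL v₂ ≡ b
      πv₂ = πL-after-01 (Factor-↝ (Factor-⊑ (suffix-⊑ ((j , b) ∷ (0 , not b) ∷ []) _) fv)) fv
      u₂≡ : u₂ ≡ (0 , b)
      u₂≡ = ↝-πL (Factor-↝ (Factor-⊑ (suffix-⊑ ((suc j , b) ∷ []) _) fu')) (trans π₂ πv₂)

  fork-extension-short : ∀ {w j b u v} → EndsWith w (j , b) → suc j < k →
    Factor (w ++ (suc j , b) ∷ u) → Factor (w ++ (0 , not b) ∷ v) → π u ≡ π v → length u ≤ 1
  fork-extension-short {u = []}                _ _ _ _ _ = z≤n
  fork-extension-short {u = _ ∷ []}            _ _ _ _ _ = ≤-refl
  fork-extension-short {u = _ ∷ _ ∷ _} {[]}    _ _ _ _ ()
  fork-extension-short {u = _ ∷ _ ∷ _} {_ ∷ []} _ _ _ _ ()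
  fork-extension-short {j = j} {b} {u₁ ∷ u₂ ∷ u} {v₁ ∷ v₂ ∷ v} ends lt fu fv πuv =
    contradiction (∷-injectiveˡ (∷-injectiveʳ πuv))
      (fork-differs-within-2 lt (Factor-⊑ (EndsWith-⊑ ends ((suc j , b) ∷ u₁ ∷ u₂ ∷ []) u) fu)
                             (Factor-⊑ (EndsWith-⊑ ends ((0 , not b) ∷ v₁ ∷ v₂ ∷ []) v) fv)
                             (∷-injectiveˡ πuv))

  fork-extension-empty : ∀ {c m u v} → m < top →
    Factor (imageOf0 c (m + k) ++ (suc m , not c) ∷ u) → Factor (imageOf0 c (m + k) ++ (0 , not (not c)) ∷ v) →
    π u ≡ π v → length u ≡ 0
  fork-extension-empty {u = []}             _ _ _ _  = refl
  fork-extension-empty {u = _ ∷ _} {[]}     _ _ _ ()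
  fork-extension-empty {c} {m} {u₁ ∷ u} {v₁ ∷ v} lt fu fv πuv =
    contradiction (Factor-suffix (imageOf0-forbidden lt) (Factor-⊑ (++-prefix-⊑ _ (_ ∷ _ ∷ []) u) fu'))
                  (forbidden-not-factor c m (s≤s lt))
    where
      ends : EndsWith (imageOf0 c (m + k)) (m , not c)
      ends = imageOf0-ends-above-k (<-trans lt ≤-refl)
      u₁≡ : u₁ ≡ (0 , not c)
      u₁≡ = proj₁ (fork-next-letters (s≤s lt) (Factor-⊑ (EndsWith-⊑ ends (_ ∷ u₁ ∷ []) u) fu)
                                                (Factor-⊑ (EndsWith-⊑ ends (_ ∷ v₁ ∷ []) v) fv) (∷-injectiveˡ πuv))
      fu' : Factor (imageOf0 c (m + k) ++ (suc m , not c) ∷ (0 , not c) ∷ u)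
      fu' = subst (λ x → Factor (imageOf0 c (m + k) ++ _ ∷ x ∷ u)) u₁≡ fu

  extension-empty-above-k : ∀ {w m c j b u v} → m < top → w ≡ imageOf0 c (m + k) → EndsWith w (j , b) →
    Factor (w ++ (suc j , b) ∷ u) → Factor (w ++ (0 , not b) ∷ v) → π u ≡ π v → length u ≡ 0
  extension-empty-above-k {m = m} {c} lt refl ends fu fv πuv
    with EndsWith-unique ends (imageOf0-ends-above-k {c} {m} (<-trans lt ≤-refl))
  ... | refl = fork-extension-empty lt fu fv πuv

  straight-extension-lengths : ∀ {w ℓ c j b u v} → w ≡ imageOf0 c ℓ → ℓ < top + k → EndsWith w (j , b) →
    suc j < k → Factor (w ++ (suc j , b) ∷ u) → Factor (w ++ (0 , not b) ∷ v) → π u ≡ π v →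
    length u ≤ 1 × (k ≤ ℓ → length u ≡ 0)
  straight-extension-lengths {c = c} w≡ bound ends lt fu fv πuv =
    fork-extension-short ends lt fu fv πuv ,
    λ k≤ℓ → let (m , m<top , ℓ≡) = above-k-view k≤ℓ bound
            in extension-empty-above-k m<top (trans w≡ (cong (imageOf0 c) ℓ≡)) ends fu fv πuv

  fork-extension-lengths : ∀ {w ℓ c j b x y u v} → w ≡ imageOf0 c ℓ → ℓ < top + k → EndsWith w (j , b) →
    suc j < k → Fork j b x y → Factor (w ++ x ∷ u) → Factor (w ++ y ∷ v) → π u ≡ π v →
    (length u ≡ length v) × (ℓ ≤ k ∸ 2 → length u ≤ 1) × (k ≤ ℓ → length u ≡ 0)
  fork-extension-lengths w≡ bound ends lt straight fu fv πuv =
    let (short , empty) = straight-extension-lengths w≡ bound ends lt fu fv πuv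
    in π-length πuv , (λ _ → short) , empty
  fork-extension-lengths w≡ bound ends lt swapped fu fv πuv =
    let (short , empty) = straight-extension-lengths w≡ bound ends lt fv fu (sym πuv)
        |u|≡|v| = π-length πuv
    in |u|≡|v| , (λ _ → subst (_≤ 1) (sym |u|≡|v|) short) , (λ k≤ℓ → trans |u|≡|v| (empty k≤ℓ))

  twinL : Letter → Letter
  twinL (j , b) = j , not b

  twin-ξ : ∀ a → twin (ξ k a) ≡ ξ k (twinL a)
  twin-ξ (zero , b)  = refl
  twin-ξ (suc j , b) with suc (suc j) <ᵇ k
  ... | true  = refl
  ... | false = refl

  twin-ξs : ∀ Z → twin (ξs Z) ≡ ξs (twin Z)
  twin-ξs []      = refl
  twin-ξs (a ∷ Z) = trans (map-++ _ (ξ k a) (ξs Z)) (cong₂ _++_ (twin-ξ a) (twin-ξs Z))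

  twin-ξ^ : ∀ i Z → twin (ξ^ k i Z) ≡ ξ^ k i (twin Z)
  twin-ξ^ zero    Z = refl
  twin-ξ^ (suc i) Z = trans (twin-ξs (ξ^ k i Z)) (cong ξs (twin-ξ^ i Z))

  imageOf0-twin : ∀ {w c ℓ} → w ≡ imageOf0 c ℓ → (w ≡ ξ^ k ℓ w0) ⊎ (twin w ≡ ξ^ k ℓ w0)
  imageOf0-twin {c = false}     eq   = inj₁ eq
  imageOf0-twin {c = true}  {ℓ} refl = inj₂ (twin-ξ^ ℓ ((0 , true) ∷ []))

  top+k≡1+2k∸2 : top + k ≡ suc (2 * k ∸ 2)
  top+k≡1+2k∸2 = cong (λ m → 3 + n + (4 + m)) (sym (+-identityʳ n))

  uPrefix-extends : ∀ m d → ∃ λ E → uPrefix (d + m) ≡ uPrefix m ++ E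
  uPrefix-extends m zero    = [] , sym (++-identityʳ _)
  uPrefix-extends m (suc d) with uPrefix-extends m d
  ... | E , eq = E ++ D , (begin
    uPrefix (suc (d + m))   ≡⟨ uPrefix-suc (d + m) ⟩
    uPrefix (d + m) ++ D    ≡⟨ cong (_++ D) eq ⟩
    (uPrefix m ++ E) ++ D   ≡⟨ ++-assoc (uPrefix m) E D ⟩
    uPrefix m ++ E ++ D     ∎)
    where
      open ≡-Reasoning
      D : List Letter
      D = ξ^ k (d + m) ((1 , false) ∷ [])

  uPrefix-long : ∀ m → m < length (uPrefix m)
  uPrefix-long zero    = s≤s z≤n
  uPrefix-long (suc m) with ξ^-nonempty m (1 , false) []
  ... | h , r , eD = begin-strict
    suc m                               <⟨ s≤s (≤-trans (uPrefix-long m) (length-++-≤ˡ (uPrefix m))) ⟩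
    suc (length (uPrefix m ++ r))       ≡⟨ sym (length-++-sucʳ (uPrefix m) h r) ⟩
    length (uPrefix m ++ h ∷ r)         ≡⟨ cong length (sym (trans (uPrefix-suc m) (cong (uPrefix m ++_) eD))) ⟩
    length (uPrefix (suc m))            ∎
    where open ≤-Reasoning

  uu-stable : ∀ {i N} → i ≤ N → uu k i ≡ at (uPrefix N) i (0 , false)
  uu-stable {i} {N} i≤N with uPrefix-extends i (N ∸ i)
  ... | E , eq = sym (begin
    at (uPrefix N) i _           ≡⟨ cong (λ M → at (uPrefix M) i _) (sym (m∸n+n≡m i≤N)) ⟩
    at (uPrefix (N ∸ i + i)) i _ ≡⟨ cong (λ L → at L i _) eq ⟩
    at (uPrefix i ++ E) i _      ≡⟨ at-++ (uPrefix i) E (uPrefix-long i) ⟩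
    at (uPrefix i) i _           ∎)
    where open ≡-Reasoning

  IsFactor⇒Factor : ∀ {t} → IsFactor k t → Factor t
  IsFactor⇒Factor {t} (i , eq) =
    N , subst (_⊑ uPrefix N) (trans slice≡ eq) (at-infix (uPrefix N) i (length t) (0 , false) (<⇒≤ (uPrefix-long N)))
    where
      N : ℕ
      N = i + length t
      slice≡ : applyUpTo (λ j → at (uPrefix N) (i + j) (0 , false)) (length t) ≡ slice k i (length t)
      slice≡ = sym (trans (map-cong-local (Allₚ.applyUpTo⁺₁ id (length t)
                                             (λ j<|t| → uu-stable (+-monoʳ-≤ i (<⇒≤ j<|t|)))))
                          (map-applyUpTo id _ (length t)))

lemma4 : (k : ℕ) → 4 ≤ k →
    (w : List Letter) → w ≢ [] → Bispecial k w →
    (x y : Letter) → InRext k w x → InRext k w y → x ≢ y → πL x ≡ πL y →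
    Σ ℕ λ ℓ → (ℓ ≤ 2 * k ∸ 2) × (ℓ ≢ k ∸ 1) ×
      ((w ≡ ξ^ k ℓ w0) ⊎ (twin w ≡ ξ^ k ℓ w0)) ×
      ((u v : List Letter) → IsFactor k (w ++ x ∷ u) → IsFactor k (w ++ y ∷ v) →
        π (w ++ x ∷ u) ≡ π (w ++ y ∷ v) →
        (length u ≡ length v) ×
        (ℓ ≤ k ∸ 2 → length u ≤ 1) ×
        (k ≤ ℓ → length u ≡ 0))
lemma4 (suc (suc (suc (suc n)))) (s≤s (s≤s (s≤s (s≤s _))))
       w w≢[] ((a , a' , a≢a' , la , la') , _) x y rx ry x≢y πxy =
  let open FixedPoint n
      fx : Factor (w ++ x ∷ [])
      fx = IsFactor⇒Factor rx
      fy : Factor (w ++ y ∷ [])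
      fy = IsFactor⇒Factor ry
      (ℓ , c , bound , ℓ≢top , w≡) =
        special-isImageOf0 (length w) ≤-refl w≢[] (a , a' , a≢a' , IsFactor⇒Factor la , IsFactor⇒Factor la')
                           (x , y , x≢y , πxy , fx , fy)
      (j , b , ends , lt , frk) = right-fork w≢[] x≢y πxy fx fy
  in ℓ , s≤s⁻¹ (subst (suc ℓ ≤_) top+k≡1+2k∸2 bound) , ℓ≢top , imageOf0-twin {w} {c} {ℓ} w≡ ,
     λ u v ru rv πeq → fork-extension-lengths w≡ bound ends lt frk (IsFactor⇒Factor ru) (IsFactor⇒Factor rv)
                                               (π-cancelˡ w πeq)
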